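{- For every integer $m\geq 3$ and every positive integer $n'$, $\lambda_1^1(P_m \times C_{5n'})=4$.
   Context: For a graph $G$, an $L(1,1)$-labeling with labels in $\{0,1,\dots,p\}$ is a function $l:V(G)\to\{0,1,\dots,p\}$ such that $l(u)\neq l(v)$ whenever the distance $d(u,v)$ is $1$ or $2$. $\lambda_1^1(G)$ denotes the least $p$ for which $G$ admits such a labeling. $P_m$ denotes the path with $m$ vertices and $C_n$ the cycle with $n$ vertices. The direct product $G\times H$ has vertex set $V(G)\times V(H)$, with $(x_1,x_2)$ adjacent to $(y_1,y_2)$ iff $x_1y_1\in E(G)$ and $x_2y_2\in E(H)$. -}

module Defs where

open import Data.Nat using (ℕ; zero; suc; _+_; _*_; _≤_; _<_; NonZero)
open import Data.Nat.DivMod using (_%_)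
open import Data.Fin using (Fin; toℕ)
open import Data.Product using (_×_; Σ; ∃; _,_)
open import Data.Sum using (_⊎_)
open import Relation.Binary.PropositionalEquality using (_≡_; _≢_)
open import Relation.Nullary using (¬_)
open import Data.Empty using (⊥)

record Graph : Set₁ where
  field
    size : ℕ
    Adj  : Fin size → Fin size → Set

open Graph public

Path : ℕ → Graph
Path m = record { size = m ; Adj = λ i j → (suc (toℕ i) ≡ toℕ j) ⊎ (suc (toℕ j) ≡ toℕ i) }

-- Cycle C_n : vertices 0..n-1, i ~ j iff j ≡ i+1 (mod n) or i ≡ j+1 (mod n).
-- (Used only for n ≥ 3, where this is the usual cycle.)
-- (For n = 0 the vertex set is empty, so the adjacency is irrelevant.)
Cycle : ℕ → Graph
Cycle zero    = record { size = zero ; Adj = λ _ _ → ⊥ }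
Cycle (suc k) = record { size = suc k
                       ; Adj = λ i j → (toℕ j ≡ suc (toℕ i) % suc k) ⊎ (toℕ i ≡ suc (toℕ j) % suc k) }

-- Direct product: vertex (x₁,x₂) encoded as x₁ , x₂ ; adjacency componentwise.
-- Vertex set is Fin a × Fin b rather than Fin (a*b); we use a general graph on any type.
record GraphT : Set₁ where
  field
    V   : Set
    Adj : V → V → Set

toT : Graph → GraphT
toT G = record { V = Fin (size G) ; Adj = Adj G }

_×ᵍ_ : Graph → Graph → GraphT
G ×ᵍ H = record { V = Fin (size G) × Fin (size H)
                ; Adj = λ { (x₁ , x₂) (y₁ , y₂) → Adj G x₁ y₁ × Adj H x₂ y₂ } }

Dist≤2 : (G : GraphT) → GraphT.V G → GraphT.V G → Set
Dist≤2 G u v = (u ≢ v) × (GraphT.Adj G u v ⊎ ∃ λ w → GraphT.Adj G u w × GraphT.Adj G w v)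

IsL11Labeling : (G : GraphT) → (p : ℕ) → (GraphT.V G → ℕ) → Set
IsL11Labeling G p l = (∀ v → l v ≤ p) × (∀ u v → Dist≤2 G u v → l u ≢ l v)

HasL11Labeling : GraphT → ℕ → Set
HasL11Labeling G p = Σ (GraphT.V G → ℕ) (IsL11Labeling G p)

λ11≡ : GraphT → ℕ → Set
λ11≡ G k = HasL11Labeling G k × (∀ p → p < k → ¬ HasL11Labeling G p)

-- Lower bound: the vertex (1, 0) of P_m × C_N has four distinct neighbours, and a vertex
-- together with its neighbours is pairwise at distance at most 2, so five labels are needed.
-- Upper bound: when 5 ∣ N, reducing both coordinates mod 5 maps P_m × C_N onto C₅ × C₅ by a
-- homomorphism that never identifies the two ends of a 2-path, so every L(1,1)-labeling of
-- C₅ × C₅ pulls back; and (a , b) ↦ b + 2a mod 5 is an L(1,1)-labeling of C₅ × C₅ with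
-- labels in {0, …, 4}.
module Submission where

open import Defs
open import Data.Nat using (ℕ; suc; _+_; _*_; _≤_; _<_; _≟_; s≤s; s≤s⁻¹; NonZero)
open import Data.Nat.DivMod
  using (_%_; _/_; _mod_; m≡m%n+[m/n]*n; [m+kn]%n≡m%n; m∣n⇒o%n%m≡o%m; m%n<n; m<n⇒m%n≡m; n%n≡0)
open import Data.Nat.Divisibility using (_∣_; m∣m*n)
open import Data.Nat.Properties
  using (1+n≢n; suc-injective; ≤-trans; m≤m+n; *-monoʳ-≤; m≤n⇒m<n∨m≡n)
open import Data.Fin as Fin using (Fin; toℕ; fromℕ; fromℕ<; remQuot; combine)
open import Data.Fin.Patterns using (0F; 1F; 2F)
open import Data.Fin.Properties
  using (toℕ-injective; toℕ-fromℕ; toℕ-fromℕ<; toℕ<n; combine-remQuot; pigeonhole; <⇒≢; all?)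
open import Data.Product using (_×_; _,_; proj₁; proj₂; map; uncurry)
open import Data.Product.Properties using (,-injective; ≡-dec)
open import Data.Sum using (_⊎_; inj₁; inj₂)
open import Data.Empty using (⊥-elim)
open import Function using (_∘_)
open import Function.Definitions using (Injective)
open import Relation.Binary.Definitions using (Symmetric; Irreflexive; Asymmetric)
open import Relation.Binary.PropositionalEquality
open import Relation.Nullary using (¬_; Dec)
open import Relation.Nullary.Decidable using (toWitness; ¬?; _→-dec_; _⊎-dec_)

open GraphT using (V)

_⊢_~_ : (G : GraphT) → V G → V G → Set
G ⊢ u ~ v = GraphT.Adj G u v

Undirected : {A : Set} → (A → A → Set) → A → A → Set
Undirected S x y = S x y ⊎ S y x

Undirected-symmetric : {A : Set} (S : A → A → Set) → Symmetric (Undirected S)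
Undirected-symmetric S (inj₁ s) = inj₂ s
Undirected-symmetric S (inj₂ s) = inj₁ s

-- Adj (Path m) and Adj (Cycle (suc k)) are, definitionally, Undirected PathStep and
-- Undirected (CycleStep k).
PathStep : {m : ℕ} → Fin m → Fin m → Set
PathStep i j = suc (toℕ i) ≡ toℕ j

CycleStep : (k : ℕ) → Fin (suc k) → Fin (suc k) → Set
CycleStep k i j = toℕ j ≡ suc (toℕ i) % suc k

Path-symmetric : (m : ℕ) → Symmetric (Adj (Path m))
Path-symmetric m = Undirected-symmetric PathStep

Path-irreflexive : (m : ℕ) → Irreflexive _≡_ (Adj (Path m))
Path-irreflexive m refl (inj₁ s) = 1+n≢n s
Path-irreflexive m refl (inj₂ s) = 1+n≢n s

Cycle-symmetric : (k : ℕ) → Symmetric (Adj (Cycle (suc k)))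
Cycle-symmetric k = Undirected-symmetric (CycleStep k)

module _ {G H : Graph} where

  ×ᵍ-symmetric : Symmetric (Adj G) → Symmetric (Adj H) → Symmetric (GraphT.Adj (G ×ᵍ H))
  ×ᵍ-symmetric symG symH {_ , _} {_ , _} (x₁~y₁ , x₂~y₂) = symG x₁~y₁ , symH x₂~y₂

  ×ᵍ-irreflexive : Irreflexive _≡_ (Adj G) → Irreflexive _≡_ (GraphT.Adj (G ×ᵍ H))
  ×ᵍ-irreflexive irrG {_ , _} refl (x₁~x₁ , _) = irrG refl x₁~x₁

module _ (G : GraphT) where

  square-clique⇒¬HasL11Labeling : {k : ℕ} (f : Fin (suc k) → V G) →
    (∀ {i j} → i ≢ j → Dist≤2 G (f i) (f j)) → ∀ p → p < k → ¬ HasL11Labeling G p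
  square-clique⇒¬HasL11Labeling f close p p<k (l , l≤p , separated)
    with i , j , i<j , same ← pigeonhole (s≤s p<k) (λ i → fromℕ< (s≤s (l≤p (f i))))
    = separated (f i) (f j) (close (<⇒≢ i<j))
        (trans (sym (toℕ-fromℕ< _)) (trans (cong toℕ same) (toℕ-fromℕ< _)))

  star : {k : ℕ} → V G → (Fin k → V G) → Fin (suc k) → V G
  star c nb 0F          = c
  star c nb (Fin.suc i) = nb i

  module _ (~-sym : Symmetric (GraphT.Adj G)) (~-irrefl : Irreflexive _≡_ (GraphT.Adj G))
           {k : ℕ} (c : V G) (nb : Fin k → V G)
           (nb-injective : Injective _≡_ _≡_ nb) (c~nb : ∀ i → G ⊢ c ~ nb i) where

    star-Dist≤2 : ∀ {i j} → i ≢ j → Dist≤2 G (star c nb i) (star c nb j)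
    star-Dist≤2 {0F}        {0F}        i≢j = ⊥-elim (i≢j refl)
    star-Dist≤2 {0F}        {Fin.suc j} _   = (λ c≡ → ~-irrefl c≡ (c~nb j)) , inj₁ (c~nb j)
    star-Dist≤2 {Fin.suc i} {0F}        _   =
      (λ ≡c → ~-irrefl (sym ≡c) (c~nb i)) , inj₁ (~-sym (c~nb i))
    star-Dist≤2 {Fin.suc i} {Fin.suc j} i≢j =
      (λ eq → i≢j (cong Fin.suc (nb-injective eq))) , inj₂ (c , ~-sym (c~nb i) , c~nb j)

    degree⇒¬HasL11Labeling : ∀ p → p < k → ¬ HasL11Labeling G p
    degree⇒¬HasL11Labeling = square-clique⇒¬HasL11Labeling (star c nb) star-Dist≤2

remQuot-injective : ∀ {a} b → Injective _≡_ _≡_ (remQuot {a} b)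
remQuot-injective {a} b {i} {j} eq = begin
  i                                 ≡⟨ combine-remQuot {a} b i ⟨
  uncurry combine (remQuot {a} b i) ≡⟨ cong (uncurry combine) eq ⟩
  uncurry combine (remQuot {a} b j) ≡⟨ combine-remQuot {a} b j ⟩
  j                                 ∎
  where open ≡-Reasoning

module _ {G H : Graph} {a b : ℕ} (f : Fin a → Fin (size G)) (g : Fin b → Fin (size H)) where

  ×ᵍ-neighbours : Fin (a * b) → V (G ×ᵍ H)
  ×ᵍ-neighbours = map f g ∘ remQuot b

  ×ᵍ-neighbours-injective : Injective _≡_ _≡_ f → Injective _≡_ _≡_ g →
    Injective _≡_ _≡_ ×ᵍ-neighbours
  ×ᵍ-neighbours-injective f-inj g-inj eq with ,-injective eq
  ... | fi≡fj , gi≡gj = remQuot-injective {a} b (cong₂ _,_ (f-inj fi≡fj) (g-inj gi≡gj))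

  ×ᵍ-neighbours-adjacent : {x : Fin (size G)} {y : Fin (size H)} →
    (∀ i → Adj G x (f i)) → (∀ j → Adj H y (g j)) → ∀ i → (G ×ᵍ H) ⊢ (x , y) ~ ×ᵍ-neighbours i
  ×ᵍ-neighbours-adjacent x~f y~g i = x~f (proj₁ (remQuot {a} b i)) , y~g (proj₂ (remQuot {a} b i))

module _ (m : ℕ) where

  Path-neighbours-of-1 : Fin 2 → Fin (3 + m)
  Path-neighbours-of-1 0F = 0F
  Path-neighbours-of-1 1F = 2F

  Path-neighbours-of-1-injective : Injective _≡_ _≡_ Path-neighbours-of-1
  Path-neighbours-of-1-injective {0F} {0F} _ = refl
  Path-neighbours-of-1-injective {1F} {1F} _ = refl
  Path-neighbours-of-1-injective {0F} {1F} ()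
  Path-neighbours-of-1-injective {1F} {0F} ()

  Path-neighbours-of-1-adjacent : ∀ i → Adj (Path (3 + m)) 1F (Path-neighbours-of-1 i)
  Path-neighbours-of-1-adjacent 0F = inj₂ refl
  Path-neighbours-of-1-adjacent 1F = inj₁ refl

module _ (k : ℕ) where

  Cycle-neighbours-of-0 : Fin 2 → Fin (3 + k)
  Cycle-neighbours-of-0 0F = 1F
  Cycle-neighbours-of-0 1F = fromℕ (2 + k)

  Cycle-neighbours-of-0-injective : Injective _≡_ _≡_ Cycle-neighbours-of-0
  Cycle-neighbours-of-0-injective {0F} {0F} _ = refl
  Cycle-neighbours-of-0-injective {1F} {1F} _ = refl
  Cycle-neighbours-of-0-injective {0F} {1F} eq
    with () ← trans (cong toℕ eq) (toℕ-fromℕ (2 + k))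
  Cycle-neighbours-of-0-injective {1F} {0F} eq
    with () ← trans (sym (toℕ-fromℕ (2 + k))) (cong toℕ eq)

  Cycle-neighbours-of-0-adjacent : ∀ i → Adj (Cycle (3 + k)) 0F (Cycle-neighbours-of-0 i)
  Cycle-neighbours-of-0-adjacent 0F = inj₁ refl
  Cycle-neighbours-of-0-adjacent 1F =
    inj₂ (sym (trans (cong (λ n → suc n % (3 + k)) (toℕ-fromℕ (2 + k))) (n%n≡0 (3 + k))))

P×C-¬HasL11Labeling : ∀ m k p → p < 4 → ¬ HasL11Labeling (Path (3 + m) ×ᵍ Cycle (3 + k)) p
P×C-¬HasL11Labeling m k =
  degree⇒¬HasL11Labeling (P ×ᵍ C)
    (×ᵍ-symmetric {P} {C} (Path-symmetric (3 + m)) (Cycle-symmetric (2 + k)))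
    (×ᵍ-irreflexive {P} {C} (Path-irreflexive (3 + m)))
    (1F , 0F) (×ᵍ-neighbours {P} {C} f g)
    (×ᵍ-neighbours-injective {P} {C} f g
      (Path-neighbours-of-1-injective m) (Cycle-neighbours-of-0-injective k))
    (×ᵍ-neighbours-adjacent {P} {C} f g
      (Path-neighbours-of-1-adjacent m) (Cycle-neighbours-of-0-adjacent k))
  where
  P = Path (3 + m)
  C = Cycle (3 + k)
  f = Path-neighbours-of-1 m
  g = Cycle-neighbours-of-0 k

-- For a symmetric G, injectivity on 2-paths is injectivity on every neighbourhood.
record IsLocallyInjectiveHom (G H : GraphT) (h : V G → V H) : Set where
  field
    preserves-~          : ∀ {u v} → G ⊢ u ~ v → H ⊢ h u ~ h v
    injective-on-2-paths : ∀ {u w v} → G ⊢ u ~ w → G ⊢ w ~ v → h u ≡ h v → u ≡ v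

open IsLocallyInjectiveHom

module _ {G H : GraphT} {h : V G → V H}
         (~-irrefl : Irreflexive _≡_ (GraphT.Adj H)) (hom : IsLocallyInjectiveHom G H h) where

  Dist≤2-map : ∀ {u v} → Dist≤2 G u v → Dist≤2 H (h u) (h v)
  Dist≤2-map (_ , inj₁ u~v) =
    (λ hu≡hv → ~-irrefl hu≡hv (preserves-~ hom u~v)) , inj₁ (preserves-~ hom u~v)
  Dist≤2-map (u≢v , inj₂ (w , u~w , w~v)) =
    u≢v ∘ injective-on-2-paths hom u~w w~v ,
    inj₂ (h w , preserves-~ hom u~w , preserves-~ hom w~v)

  HasL11Labeling-pullback : ∀ {p} → HasL11Labeling H p → HasL11Labeling G p
  HasL11Labeling-pullback (l , l≤p , separated) =
    l ∘ h , l≤p ∘ h , λ u v → separated (h u) (h v) ∘ Dist≤2-map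

×ᵍ-isLocallyInjectiveHom : {G₁ G₂ H₁ H₂ : Graph}
  {h₁ : Fin (size G₁) → Fin (size H₁)} {h₂ : Fin (size G₂) → Fin (size H₂)} →
  IsLocallyInjectiveHom (toT G₁) (toT H₁) h₁ → IsLocallyInjectiveHom (toT G₂) (toT H₂) h₂ →
  IsLocallyInjectiveHom (G₁ ×ᵍ G₂) (H₁ ×ᵍ H₂) (map h₁ h₂)
preserves-~ (×ᵍ-isLocallyInjectiveHom hom₁ hom₂) {_ , _} {_ , _} (u₁~v₁ , u₂~v₂) =
  preserves-~ hom₁ u₁~v₁ , preserves-~ hom₂ u₂~v₂
injective-on-2-paths (×ᵍ-isLocallyInjectiveHom hom₁ hom₂) {_ , _} {_ , _} {_ , _}
  (u₁~w₁ , u₂~w₂) (w₁~v₁ , w₂~v₂) eq with ,-injective eq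
... | eq₁ , eq₂ = cong₂ _,_ (injective-on-2-paths hom₁ u₁~w₁ w₁~v₁ eq₁)
                            (injective-on-2-paths hom₂ u₂~w₂ w₂~v₂ eq₂)

module _ {A B : Set} {S : A → A → Set} {T : B → B → Set} {h : A → B}
         (S⇒T : ∀ {x y} → S x y → T (h x) (h y))
         (S-functional : ∀ {w u v} → S w u → S w v → u ≡ v)
         (S-injective : ∀ {u v w} → S u w → S v w → u ≡ v)
         (T-asym : Asymmetric T) where

  Undirected-isLocallyInjectiveHom :
    IsLocallyInjectiveHom (record { V = A ; Adj = Undirected S })
                          (record { V = B ; Adj = Undirected T }) h
  preserves-~ Undirected-isLocallyInjectiveHom (inj₁ s) = inj₁ (S⇒T s)
  preserves-~ Undirected-isLocallyInjectiveHom (inj₂ s) = inj₂ (S⇒T s)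
  injective-on-2-paths Undirected-isLocallyInjectiveHom {w = w} (inj₁ u→w) (inj₁ w→v) hu≡hv =
    ⊥-elim (T-asym (subst (λ z → T z (h w)) hu≡hv (S⇒T u→w)) (S⇒T w→v))
  injective-on-2-paths Undirected-isLocallyInjectiveHom (inj₁ u→w) (inj₂ v→w) _ = S-injective u→w v→w
  injective-on-2-paths Undirected-isLocallyInjectiveHom (inj₂ w→u) (inj₁ w→v) _ = S-functional w→u w→v
  injective-on-2-paths Undirected-isLocallyInjectiveHom {w = w} (inj₂ w→u) (inj₂ v→w) hu≡hv =
    ⊥-elim (T-asym (S⇒T w→u) (subst (λ z → T z (h w)) (sym hu≡hv) (S⇒T v→w)))

toℕ-mod : ∀ m n .{{_ : NonZero n}} → toℕ (m mod n) ≡ m % n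
toℕ-mod m n = toℕ-fromℕ< (m%n<n m n)

[1+m]%n≡[1+m%n]%n : ∀ m n .{{_ : NonZero n}} → suc m % n ≡ suc (m % n) % n
[1+m]%n≡[1+m%n]%n m n = begin
  suc m % n                   ≡⟨ cong (λ x → suc x % n) (m≡m%n+[m/n]*n m n) ⟩
  suc (m % n + m / n * n) % n ≡⟨ [m+kn]%n≡m%n (suc (m % n)) (m / n) n ⟩
  suc (m % n) % n             ∎
  where open ≡-Reasoning

[1+m]%n-injective : ∀ {m o n} .{{_ : NonZero n}} → m < n → o < n → suc m % n ≡ suc o % n → m ≡ o
[1+m]%n-injective {n = n} m<n o<n eq
  with m≤n⇒m<n∨m≡n m<n | m≤n⇒m<n∨m≡n o<n
... | inj₁ 1+m<n | inj₁ 1+o<n =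
  suc-injective (trans (sym (m<n⇒m%n≡m 1+m<n)) (trans eq (m<n⇒m%n≡m 1+o<n)))
... | inj₂ 1+m≡n | inj₂ 1+o≡n = suc-injective (trans 1+m≡n (sym 1+o≡n))
... | inj₁ 1+m<n | inj₂ refl
  with () ← trans (sym (m<n⇒m%n≡m 1+m<n)) (trans eq (n%n≡0 n))
... | inj₂ refl | inj₁ 1+o<n
  with () ← trans (sym (m<n⇒m%n≡m 1+o<n)) (trans (sym eq) (n%n≡0 n))

%-successor⇒CycleStep-mod : ∀ d {a b} → b % suc d ≡ suc a % suc d →
  CycleStep d (a mod suc d) (b mod suc d)
%-successor⇒CycleStep-mod d {a} {b} b≡1+a = begin
  toℕ (b mod suc d)           ≡⟨ toℕ-mod b (suc d) ⟩
  b % suc d                   ≡⟨ b≡1+a ⟩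
  suc a % suc d               ≡⟨ [1+m]%n≡[1+m%n]%n a (suc d) ⟩
  suc (a % suc d) % suc d     ≡⟨ cong (λ x → suc x % suc d) (toℕ-mod a (suc d)) ⟨
  suc (toℕ (a mod suc d)) % suc d ∎
  where open ≡-Reasoning

module _ (d : ℕ) (CycleStep-asym : Asymmetric (CycleStep d)) where

  Path→Cycle-isLocallyInjectiveHom : ∀ m →
    IsLocallyInjectiveHom (toT (Path m)) (toT (Cycle (suc d))) (λ i → toℕ i mod suc d)
  Path→Cycle-isLocallyInjectiveHom m = Undirected-isLocallyInjectiveHom
    (λ {i} {j} i→j → %-successor⇒CycleStep-mod d {b = toℕ j} (cong (_% suc d) (sym i→j)))
    (λ w→u w→v → toℕ-injective (trans (sym w→u) w→v))
    (λ u→w v→w → toℕ-injective (suc-injective (trans u→w (sym v→w))))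
    CycleStep-asym

  Cycle→Cycle-isLocallyInjectiveHom : ∀ k → suc d ∣ suc k →
    IsLocallyInjectiveHom (toT (Cycle (suc k))) (toT (Cycle (suc d))) (λ i → toℕ i mod suc d)
  Cycle→Cycle-isLocallyInjectiveHom k d∣N = Undirected-isLocallyInjectiveHom
    (λ {i} {j} i→j → %-successor⇒CycleStep-mod d {b = toℕ j}
      (trans (cong (_% suc d) i→j) (m∣n⇒o%n%m≡o%m (suc d) (suc k) (suc (toℕ i)) d∣N)))
    (λ w→u w→v → toℕ-injective (trans w→u (sym w→v)))
    (λ {u} {v} u→w v→w → toℕ-injective
      ([1+m]%n-injective (toℕ<n u) (toℕ<n v) (trans (sym u→w) v→w)))
    CycleStep-asym

CycleStep? : ∀ k (i j : Fin (suc k)) → Dec (CycleStep k i j)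
CycleStep? k i j = toℕ j ≟ suc (toℕ i) % suc k

Cycle-adj? : ∀ k (i j : Fin (suc k)) → Dec (Adj (Cycle (suc k)) i j)
Cycle-adj? k i j = CycleStep? k i j ⊎-dec CycleStep? k j i

CycleStep₅-asymmetric : Asymmetric (CycleStep 4)
CycleStep₅-asymmetric {i} {j} = toWitness {a? = all? λ i → all? λ j →
  CycleStep? 4 i j →-dec ¬? (CycleStep? 4 j i)} _ i j

Cycle₅-irreflexive : Irreflexive _≡_ (Adj (Cycle 5))
Cycle₅-irreflexive {i} refl = toWitness {a? = all? λ i → ¬? (Cycle-adj? 4 i i)} _ i

-- Each of the four steps (±1, ±1) changes b + 2a by one of ±1, ±3: these are distinct and
-- nonzero mod 5.
C₅×C₅-label : Fin 5 × Fin 5 → ℕ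
C₅×C₅-label (a , b) = (toℕ b + 2 * toℕ a) % 5

C₅×C₅-HasL11Labeling : HasL11Labeling (Cycle 5 ×ᵍ Cycle 5) 4
C₅×C₅-HasL11Labeling =
  C₅×C₅-label , (λ (a , b) → s≤s⁻¹ (m%n<n (toℕ b + 2 * toℕ a) 5)) , separated
  where
  separated : ∀ u v → Dist≤2 (Cycle 5 ×ᵍ Cycle 5) u v → C₅×C₅-label u ≢ C₅×C₅-label v
  separated (a , b) (a′ , b′) (_ , inj₁ (a~a′ , b~b′)) = toWitness {a? =
    all? λ a → all? λ b → all? λ a′ → all? λ b′ →
    Cycle-adj? 4 a a′ →-dec (Cycle-adj? 4 b b′ →-dec
      ¬? (C₅×C₅-label (a , b) ≟ C₅×C₅-label (a′ , b′)))} _ a b a′ b′ a~a′ b~b′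
  separated (a , b) (a′ , b′) (u≢v , inj₂ ((a₀ , b₀) , (a~a₀ , b~b₀) , (a₀~a′ , b₀~b′))) =
    toWitness {a? =
      all? λ a → all? λ b → all? λ a₀ → all? λ b₀ → all? λ a′ → all? λ b′ →
      Cycle-adj? 4 a a₀ →-dec (Cycle-adj? 4 b b₀ →-dec (Cycle-adj? 4 a₀ a′ →-dec
        (Cycle-adj? 4 b₀ b′ →-dec (¬? (≡-dec Fin._≟_ Fin._≟_ (a , b) (a′ , b′)) →-dec
          ¬? (C₅×C₅-label (a , b) ≟ C₅×C₅-label (a′ , b′))))))}
      _ a b a₀ b₀ a′ b′ a~a₀ b~b₀ a₀~a′ b₀~b′ u≢v

P×C-HasL11Labeling : ∀ m k → 5 ∣ suc k → HasL11Labeling (Path m ×ᵍ Cycle (suc k)) 4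
P×C-HasL11Labeling m k 5∣N =
  HasL11Labeling-pullback (×ᵍ-irreflexive {Cycle 5} {Cycle 5} Cycle₅-irreflexive)
    (×ᵍ-isLocallyInjectiveHom
      (Path→Cycle-isLocallyInjectiveHom 4 CycleStep₅-asymmetric m)
      (Cycle→Cycle-isLocallyInjectiveHom 4 CycleStep₅-asymmetric k 5∣N))
    C₅×C₅-HasL11Labeling

λ11[P×C]≡4 : ∀ m N → 3 ≤ m → 3 ≤ N → 5 ∣ N → λ11≡ (Path m ×ᵍ Cycle N) 4
λ11[P×C]≡4 (suc (suc (suc m))) (suc (suc (suc k)))
  (s≤s (s≤s (s≤s _))) (s≤s (s≤s (s≤s _))) 5∣N =
  P×C-HasL11Labeling (3 + m) (2 + k) 5∣N , P×C-¬HasL11Labeling m k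

mainTheorem12 : (m n′ : ℕ) → 3 ≤ m → 1 ≤ n′ →
    λ11≡ (Path m ×ᵍ Cycle (5 * n′)) 4
mainTheorem12 m n′ 3≤m 1≤n′ =
  λ11[P×C]≡4 m (5 * n′) 3≤m (≤-trans (m≤m+n 3 2) (*-monoʳ-≤ 5 1≤n′)) (m∣m*n n′)
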